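{- Let $B \subseteq \{0,1\}^n$, $A \subseteq B$, and let an injective mapping $p : A \to B$ be given. Let $\mathcal{Q}_A := \{\bigcap_{a\in A}\mathbf{SP}(a)(k) \mid k\in[n]\}$ be the intersection of the partitions $\mathbf{SP}(a)$, $a\in A$. There is an assignment of positions to parts $Q_p : [n] \to \mathcal{Q}_A$ with $|Q_p^{ -1}(P)| = |P|$ for every $P \in \mathcal{Q}_A$, such that every $\pi \in \mathbf{Sym}_n$ realising any $\sigma \in \mathbf{Sym}(B)$ with $\sigma^{ -1}(a) = p(a)$ for all $a \in A$ satisfies $\pi(k) \in Q_p(k)$ for all $k \in [n]$ (such a $\pi$ may not exist).
   Context: $\mathbf{Sym}_n$ acts on $\{0,1\}^n$ by permuting positions: $\pi(v) = v_{\pi^{ -1}(1)}\cdots v_{\pi^{ -1}(n)}$. For a string $a\in\{0,1\}^n$, $\mathbf{SP}(a)$ is the partition of $[n]$ into $\{k\mid a_k=0\}$ and $\{k\mid a_k=1\}$; for a partition $\mathcal{P}$, $\mathcal{P}(k)$ is the part containing $k$. $\mathbf{Sym}(B)$ is the group of all permutations of the strings in $B$, and $\pi\in\mathbf{Sym}_n$ realises $\sigma\in\mathbf{Sym}(B)$ if $\pi(b)=\sigma(b)$ for every $b\in B$. -}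

module Defs where

open import Data.Nat using (ℕ; zero; suc)
open import Data.Bool using (Bool; true; false; T; not; _∨_; _∧_)
import Data.Bool as Bool
open import Data.Fin using (Fin)
open import Data.Vec using (Vec; []; _∷_; lookup; tabulate)
open import Data.Vec.Properties using (≡-dec)
open import Data.List using (List; []; _∷_; _++_; map; foldr)
open import Data.Fin.Subset using (Subset; ∣_∣)
open import Data.Fin.Permutation using (Permutation′; _⟨$⟩ʳ_; _⟨$⟩ˡ_)
open import Data.Product using (Σ; proj₁; _,_)
open import Function using (_∘_)
open import Function.Bundles using (_↔_; Inverse)
open import Relation.Nullary using (does)
open import Relation.Binary.PropositionalEquality using (_≡_)

-- Binary strings of length n ({0,1}^n), with false = 0 and true = 1.
Str : ℕ → Set
Str n = Vec Bool n

StrSet : ℕ → Set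
StrSet n = Str n → Bool

Elem : ∀ {n} → StrSet n → Set
Elem {n} B = Σ (Str n) (T ∘ B)

strings : (n : ℕ) → List (Str n)
strings zero = [] ∷ []
strings (suc n) = map (false ∷_) (strings n) ++ map (true ∷_) (strings n)

Sym : ∀ {n} → StrSet n → Set
Sym B = Elem B ↔ Elem B

act : ∀ {n} → Permutation′ n → Str n → Str n
act π v = tabulate (λ i → lookup v (π ⟨$⟩ˡ i))

Realises : ∀ {n} {B : StrSet n} → Permutation′ n → Sym B → Set
Realises {n} {B} π σ = (b : Str n) (h : T (B b)) → act π b ≡ proj₁ (Inverse.to σ (b , h))

-- The part of Q_A = ⋂_{a∈A} SP(a) containing position j:
-- { i | a_i = a_j for every a ∈ A } (as a subset of [n]).
part : ∀ {n} → StrSet n → Fin n → Subset n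
part {n} A j = tabulate (λ i → foldr (λ a r → (not (A a) ∨ does (lookup a i Bool.≟ lookup a j)) ∧ r) true (strings n))

InQ : ∀ {n} → StrSet n → Subset n → Set
InQ {n} A P = Σ (Fin n) (λ j → P ≡ part A j)

preimageSize : ∀ {n} → (Fin n → Subset n) → Subset n → ℕ
preimageSize Q P = ∣ tabulate (λ k → does (≡-dec Bool._≟_ (Q k) P)) ∣

{-# OPTIONS --safe #-}

-- A permutation ρ realising such a σ sends p(a) to a for every a ∈ A, so it is
-- "compatible": a_{ρ(k)} = p(a)_k for all a ∈ A and all k.  Whether a
-- compatible permutation exists is decidable by exhaustive search: if none
-- exists, any assignment works vacuously; otherwise we fix one, π₀, and put
-- Q(k) := the part of π₀(k).  Any compatible ρ agrees with π₀ on every a ∈ A, so ρ(k) lies in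
-- the part of π₀(k); and Q⁻¹(P) = π₀⁻¹(P) has |P| elements because π₀ is a
-- bijection.
module Submission where

open import Defs
open import Data.Nat using (ℕ; zero; suc)
open import Data.Nat.Properties using (+-0-commutativeMonoid)
open import Data.Bool using (Bool; true; false; T; not; _∨_; if_then_else_)
import Data.Bool as Bool
open import Data.Bool.Properties using (T-irrelevant; T-≡)
open import Data.Bool.ListAction using (all)
open import Data.Empty using (⊥-elim)
open import Data.Fin using (Fin; zero; suc)
open import Data.Fin.Properties using (any?; all?; _≟_)
open import Data.Fin.Subset using (Subset; _∈_; ∣_∣)
open import Data.Fin.Permutation using (Permutation′; _⟨$⟩ʳ_; _⟨$⟩ˡ_; permutation; inverseˡ; inverseʳ)
import Data.Fin.Permutation as Perm
open import Data.List.Properties using (foldr-map)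
open import Data.List.Membership.Propositional using () renaming (_∈_ to _∈ₗ_)
open import Data.List.Membership.Propositional.Properties using (∈-++⁺ˡ; ∈-++⁺ʳ; ∈-map⁺)
open import Data.List.Relation.Unary.All as All using (All)
open import Data.List.Relation.Unary.All.Properties using (all⁺; all⁻)
open import Data.List.Relation.Unary.Any using (here)
open import Data.Product using (Σ; ∃; _×_; _,_; proj₁)
open import Data.Vec using (Vec; []; _∷_; lookup; tabulate)
open import Data.Vec.Properties using (lookup∘tabulate; tabulate∘lookup; tabulate-cong; lookup⇒[]=; ≡-dec)
import Data.Vec.Functional as Vector
open import Function using (_∘_; _⇔_; mk⇔; Equivalence)
open import Function.Bundles using (Inverse)
open import Function.Definitions using (Injective)
open import Relation.Binary.PropositionalEquality using (_≡_; _≗_; refl; sym; trans; cong; subst; module ≡-Reasoning)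
open import Relation.Nullary using (Dec; yes; no; does; map′; _×-dec_)
open import Relation.Nullary.Decidable using (does-⇔; T?)
open import Algebra.Properties.CommutativeMonoid.Sum +-0-commutativeMonoid using (sum; sum-permute)

open Equivalence using (to; from)

T-not∨does : ∀ {ℓ} {P : Set ℓ} {b} (P? : Dec P) → T (not b ∨ does P?) ⇔ (T b → P)
T-not∨does {b = false} P?      = mk⇔ (λ _ ()) _
T-not∨does {b = true}  (yes p) = mk⇔ (λ _ _ → p) _
T-not∨does {b = true}  (no ¬p) = mk⇔ (λ ()) (λ f → ¬p (f _))

∀-T? : ∀ {ℓ} (b : Bool) {P : T b → Set ℓ} → (∀ h → Dec (P h)) → Dec (∀ h → P h)
∀-T? false P? = yes λ ()
∀-T? true  P? = map′ (λ p _ → p) (λ f → f _) (P? _)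

Vec-ext : ∀ {a} {A : Set a} {n} {xs ys : Vec A n} → lookup xs ≗ lookup ys → xs ≡ ys
Vec-ext {xs = xs} {ys} eq =
  trans (sym (tabulate∘lookup xs)) (trans (tabulate-cong eq) (tabulate∘lookup ys))

∈-strings : ∀ {n} (v : Str n) → v ∈ₗ strings n
∈-strings []          = here refl
∈-strings (false ∷ v) = ∈-++⁺ˡ (∈-map⁺ (false ∷_) (∈-strings v))
∈-strings (true  ∷ v) = ∈-++⁺ʳ _ (∈-map⁺ (true ∷_) (∈-strings v))

module _ {ℓ} {n} {P : Str n → Set ℓ} where

  All-strings⇔ : All P (strings n) ⇔ (∀ v → P v)
  All-strings⇔ = mk⇔ (λ ps v → All.lookup ps (∈-strings v)) (λ ps → All.tabulate (λ {v} _ → ps v))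

  ∀-Str? : (∀ v → Dec (P v)) → Dec (∀ v → P v)
  ∀-Str? P? = map′ (to All-strings⇔) (from All-strings⇔) (All.all? P? (strings n))

any-function? : ∀ {ℓ} m {n} {P : (Fin m → Fin n) → Set ℓ} →
                (∀ {f g} → f ≗ g → P f → P g) → (∀ f → Dec (P f)) → Dec (∃ P)
any-function? zero {n} resp P? = map′ (empty ,_) (λ (f , p) → resp (λ ()) p) (P? empty)
  where
  empty : Fin 0 → Fin n
  empty ()
any-function? (suc m) resp P? =
  map′ (λ (x , g , p) → x Vector.∷ g , p)
       (λ (f , p) → f zero , f ∘ suc , resp head∷tail p)
       (any? λ x → any-function? m (λ f≗g → resp λ { zero → refl ; (suc i) → f≗g i })
                                   (P? ∘ (x Vector.∷_)))
  where
  head∷tail : ∀ {f} → f ≗ f zero Vector.∷ (f ∘ suc)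
  head∷tail zero    = refl
  head∷tail (suc i) = refl

module _ {n : ℕ} where

  Inverses : (f g : Fin n → Fin n) → Set
  Inverses f g = (∀ i → f (g i) ≡ i) × (∀ i → g (f i) ≡ i)

  inverses? : ∀ f g → Dec (Inverses f g)
  inverses? f g = all? (λ i → f (g i) ≟ i) ×-dec all? (λ i → g (f i) ≟ i)

  any-permutation? : ∀ {ℓ} {P : (Fin n → Fin n) → Set ℓ} →
                     (∀ {f g} → f ≗ g → P f → P g) → (∀ f → Dec (P f)) →
                     Dec (∃ λ (π : Permutation′ n) → P (π ⟨$⟩ʳ_))
  any-permutation? {P = P} resp P? =
    map′ (λ (f , pf , g , fg , gf) → permutation f g fg gf , pf)
         (λ (π , pπ) → π ⟨$⟩ʳ_ , pπ , π ⟨$⟩ˡ_ , (λ _ → inverseʳ π) , (λ _ → inverseˡ π))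
         (any-function? n resp′ (λ f → P? f ×-dec any-function? n (resp-inverse f) (inverses? f)))
    where
    resp-inverse : ∀ f {g g′} → g ≗ g′ → Inverses f g → Inverses f g′
    resp-inverse f g≗g′ (fg , gf) =
      (λ i → trans (cong f (sym (g≗g′ i))) (fg i)) , (λ i → trans (sym (g≗g′ (f i))) (gf i))

    resp′ : ∀ {f f′} → f ≗ f′ → P f × ∃ (Inverses f) → P f′ × ∃ (Inverses f′)
    resp′ f≗f′ (pf , g , fg , gf) =
      resp f≗f′ pf , g ,
      (λ i → trans (sym (f≗f′ (g i))) (fg i)) , (λ i → trans (cong g (sym (f≗f′ i))) (gf i))

∣tabulate∣≡sum : ∀ {n} (g : Fin n → Bool) → ∣ tabulate g ∣ ≡ sum (λ i → if g i then 1 else 0)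
∣tabulate∣≡sum {zero}  g = refl
∣tabulate∣≡sum {suc n} g with g zero
... | true  = cong suc (∣tabulate∣≡sum (g ∘ suc))
... | false = ∣tabulate∣≡sum (g ∘ suc)

∣tabulate-lookup∘permute∣ : ∀ {n} (P : Subset n) (π : Permutation′ n) →
                            ∣ tabulate (lookup P ∘ (π ⟨$⟩ʳ_)) ∣ ≡ ∣ P ∣
∣tabulate-lookup∘permute∣ {n} P π = begin
  ∣ tabulate (lookup P ∘ (π ⟨$⟩ʳ_)) ∣       ≡⟨ ∣tabulate∣≡sum (lookup P ∘ (π ⟨$⟩ʳ_)) ⟩
  sum (indicator ∘ (π ⟨$⟩ʳ_))               ≡⟨ sym (sum-permute indicator π) ⟩
  sum indicator                             ≡⟨ sym (∣tabulate∣≡sum (lookup P)) ⟩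
  ∣ tabulate (lookup P) ∣                   ≡⟨ cong ∣_∣ (tabulate∘lookup P) ⟩
  ∣ P ∣                                     ∎
  where
  open ≡-Reasoning
  indicator : Fin n → ℕ
  indicator i = if lookup P i then 1 else 0

module _ {n} (A : StrSet n) where

  Agree : Fin n → Fin n → Set
  Agree i j = ∀ a → T (A a) → lookup a i ≡ lookup a j

  T-lookup-part : ∀ i j → T (lookup (part A j) i) ⇔ Agree i j
  T-lookup-part i j = mk⇔
    (λ t a → to (clause⇔ a) (to All-strings⇔ (all⁺ clause _ (subst T lookup-part≡all t)) a))
    (λ ag → subst T (sym lookup-part≡all) (all⁻ clause (from All-strings⇔ λ a → from (clause⇔ a) (ag a))))
    where
    clause : Str n → Bool
    clause a = not (A a) ∨ does (lookup a i Bool.≟ lookup a j)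

    clause⇔ : ∀ a → T (clause a) ⇔ (T (A a) → lookup a i ≡ lookup a j)
    clause⇔ a = T-not∨does (lookup a i Bool.≟ lookup a j)

    lookup-part≡all : lookup (part A j) i ≡ all clause (strings n)
    lookup-part≡all = trans (lookup∘tabulate _ i) (sym (foldr-map Bool._∧_ clause true (strings n)))

  agree⇒∈part : ∀ {i j} → Agree i j → i ∈ part A j
  agree⇒∈part ag = lookup⇒[]= _ _ (to T-≡ (from (T-lookup-part _ _) ag))

  agree⇒part≡ : ∀ {i j} → Agree i j → part A i ≡ part A j
  agree⇒part≡ {i} {j} ag = Vec-ext λ k → does-⇔ (T-lookup-part-agree k) (T? _) (T? _)
    where
    T-lookup-part-agree : ∀ k → T (lookup (part A i) k) ⇔ T (lookup (part A j) k)
    T-lookup-part-agree k = mk⇔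
      (λ t → from (T-lookup-part k j) λ a h → trans (to (T-lookup-part k i) t a h) (ag a h))
      (λ t → from (T-lookup-part k i) λ a h → trans (to (T-lookup-part k j) t a h) (sym (ag a h)))

  part≡⇔T-lookup-part : ∀ i j → (part A i ≡ part A j) ⇔ T (lookup (part A j) i)
  part≡⇔T-lookup-part i j = mk⇔
    (λ eq → subst (λ P → T (lookup P i)) eq (from (T-lookup-part i i) λ _ _ → refl))
    (agree⇒part≡ ∘ to (T-lookup-part i j))

  preimageSize-part∘permute : (π : Permutation′ n) (P : Subset n) → InQ A P →
                              preimageSize (part A ∘ (π ⟨$⟩ʳ_)) P ≡ ∣ P ∣
  preimageSize-part∘permute π .(part A j) (j , refl) =
    trans (cong (∣_∣ {n}) (tabulate-cong λ k →
             does-⇔ (part≡⇔T-lookup-part (π ⟨$⟩ʳ k) j) (≡-dec Bool._≟_ _ _) (T? (lookup (part A j) (π ⟨$⟩ʳ k)))))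
          (∣tabulate-lookup∘permute∣ (part A j) π)

lookup-act : ∀ {n} (π : Permutation′ n) (v : Str n) k → lookup (act π v) (π ⟨$⟩ʳ k) ≡ lookup v k
lookup-act π v k = trans (lookup∘tabulate _ (π ⟨$⟩ʳ k)) (cong (lookup v) (inverseˡ π))

module _ {n} {B A : StrSet n} (p : Elem A → Elem B) where

  Compatible : (Fin n → Fin n) → Set
  Compatible f = ∀ a (h : T (A a)) k → lookup a (f k) ≡ lookup (proj₁ (p (a , h))) k

  compatible? : ∀ f → Dec (Compatible f)
  compatible? f = ∀-Str? λ a → ∀-T? (A a) λ h → all? λ k →
                    lookup a (f k) Bool.≟ lookup (proj₁ (p (a , h))) k

  compatible-resp : ∀ {f g} → f ≗ g → Compatible f → Compatible g
  compatible-resp f≗g c a h k = trans (cong (lookup a) (sym (f≗g k))) (c a h k)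

  compatible⇒agree : ∀ {f g} → Compatible f → Compatible g → ∀ k → Agree A (f k) (g k)
  compatible⇒agree cf cg k a h = trans (cf a h k) (sym (cg a h k))

  realiser-compatible : (A⊆B : ∀ a → T (A a) → T (B a)) (π : Permutation′ n) (σ : Sym B) → Realises π σ →
                        (∀ a (h : T (A a)) → proj₁ (Inverse.from σ (a , A⊆B a h)) ≡ proj₁ (p (a , h))) →
                        Compatible (π ⟨$⟩ʳ_)
  realiser-compatible A⊆B π σ realises σ⁻¹≡p a h k = begin
    lookup a (π ⟨$⟩ʳ k)                            ≡⟨ cong (λ v → lookup v (π ⟨$⟩ʳ k)) (sym act-p) ⟩
    lookup (act π (proj₁ (p (a , h)))) (π ⟨$⟩ʳ k)  ≡⟨ lookup-act π (proj₁ (p (a , h))) k ⟩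
    lookup (proj₁ (p (a , h))) k                   ∎
    where
    open ≡-Reasoning
    σ⁻¹a≡pa : Inverse.from σ (a , A⊆B a h) ≡ p (a , h)
    σ⁻¹a≡pa with Inverse.from σ (a , A⊆B a h) | σ⁻¹≡p a h
    ... | _ , h′ | refl = cong (_ ,_) (T-irrelevant h′ _)

    act-p : act π (proj₁ (p (a , h))) ≡ a
    act-p = begin
      act π (proj₁ (p (a , h)))                              ≡⟨ realises _ _ ⟩
      proj₁ (Inverse.to σ (p (a , h)))                       ≡⟨ cong (proj₁ ∘ Inverse.to σ) (sym σ⁻¹a≡pa) ⟩
      proj₁ (Inverse.to σ (Inverse.from σ (a , A⊆B a h)))   ≡⟨ cong proj₁ (Inverse.strictlyInverseˡ σ _) ⟩
      a                                                      ∎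

  agreeing-permutation : Σ (Permutation′ n) λ π₀ →
                         ∀ π → Compatible (π ⟨$⟩ʳ_) → ∀ k → Agree A (π ⟨$⟩ʳ k) (π₀ ⟨$⟩ʳ k)
  agreeing-permutation with any-permutation? compatible-resp compatible?
  ... | yes (π₀ , c₀) = π₀ , λ π c → compatible⇒agree c c₀
  ... | no ¬c         = Perm.id , λ π c → ⊥-elim (¬c (π , c))

lemma26 : (n : ℕ) (B A : StrSet n) (A⊆B : (a : Str n) → T (A a) → T (B a))
          (p : Elem A → Elem B) → Injective _≡_ _≡_ p →
          Σ (Fin n → Subset n) (λ Q →
            ((k : Fin n) → InQ A (Q k))
            × ((P : Subset n) → InQ A P → preimageSize Q P ≡ ∣ P ∣)
            × ((π : Permutation′ n) (σ : Sym B) → Realises π σ →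
               ((a : Str n) (h : T (A a)) →
                 proj₁ (Inverse.from σ (a , A⊆B a h)) ≡ proj₁ (p (a , h))) →
               (k : Fin n) → (π ⟨$⟩ʳ k) ∈ Q k))
lemma26 n B A A⊆B p _ with agreeing-permutation p
... | π₀ , agrees =
  part A ∘ (π₀ ⟨$⟩ʳ_) ,
  (λ k → π₀ ⟨$⟩ʳ k , refl) ,
  preimageSize-part∘permute A π₀ ,
  λ π σ realises σ⁻¹≡p k → agree⇒∈part A (agrees π (realiser-compatible p A⊆B π σ realises σ⁻¹≡p) k)
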